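{- Let $\lambda>1$ be an ordinal and let $n\geq 0$ be an integer. The set of nonzero ordinals $z<\omega^{\omega^\lambda}$ satisfying $$z\,(\omega+1)^{n}(\omega^2+1)=(\omega+1)^{n}(\omega^2+1)\,z$$ is exactly $\{((\omega+1)^{n}(\omega^2+1))^{r} \mid r \text{ a nonnegative integer}\}$.
   Context: All products are ordinal products (ordinal multiplication, which is associative and noncommutative); powers with integer exponents are iterated ordinal products. -}

module Defs where

open import Level using (Level; 0ℓ) renaming (suc to lsuc)
open import Data.Nat using (ℕ; zero; suc)
open import Data.Maybe using (Maybe; nothing; just)
open import Data.Product using (_×_)

-- Classically, every (Set-sized) ordinal is denoted by such a tree, and the
-- order _≤_ below is exactly the ordinal order of the denotations.
data Ord : Set₁ where
  ozero : Ord
  osucc : Ord → Ord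
  osup  : {I : Set} → (I → Ord) → Ord

-- The order on Brouwer trees (Kraus–Nordvall Forsberg–Xu style).
data _≤_ : Ord → Ord → Set₁ where
  ≤-zero     : ∀ {y} → ozero ≤ y
  ≤-succ     : ∀ {x y} → x ≤ y → osucc x ≤ osucc y
  ≤-cocone   : ∀ {x} {I : Set} {f : I → Ord} (k : I) → x ≤ f k → x ≤ osup f
  ≤-limiting : ∀ {y} {I : Set} {f : I → Ord} → (∀ k → f k ≤ y) → osup f ≤ y

infix 4 _≤_ _<_ _≈_

_<_ : Ord → Ord → Set₁
x < y = osucc x ≤ y

_≈_ : Ord → Ord → Set₁
x ≈ y = (x ≤ y) × (y ≤ x)

fin : ℕ → Ord
fin zero    = ozero
fin (suc n) = osucc (fin n)

oone : Ord
oone = osucc ozero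

ω : Ord
ω = osup fin

infixl 6 _+_
infixl 7 _*_
infixr 8 _^_ _^ⁿ_

-- Ordinal addition (continuous in the right argument; the extra `nothing`
-- branch makes  x + sup ∅ = x  and gives correct values for all suprema).
_+_ : Ord → Ord → Ord
x + ozero   = x
x + osucc y = osucc (x + y)
x + osup {I} f = osup {Maybe I} g
  where
  g : Maybe I → Ord
  g nothing  = x
  g (just i) = x + f i

_*_ : Ord → Ord → Ord
x * ozero   = ozero
x * osucc y = x * y + x
x * osup f  = osup (λ i → x * f i)

-- Ordinal exponentiation (the `nothing` branch gives x ^ sup ∅ = 1).
_^_ : Ord → Ord → Ord
x ^ ozero   = oone
x ^ osucc y = x ^ y * x
x ^ osup {I} f = osup {Maybe I} g
  where
  g : Maybe I → Ord
  g nothing  = oone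
  g (just i) = x ^ f i

_^ⁿ_ : Ord → ℕ → Ord
x ^ⁿ zero  = oone
x ^ⁿ suc n = x ^ⁿ n * x

P : ℕ → Ord
P n = (osucc ω) ^ⁿ n * osucc (ω * ω)

-- Below ω^ω an ordinal is determined by its Cantor normal form, here its list of coefficients.
-- For a normal form a with nonzero constant coefficient, a·P and P·a are normal forms again, with
-- coefficient lists a ++ P-high n and P-low n ++ a, so commuting with P is a word equation whose
-- solutions are exactly the coefficient lists of the powers of P. A zero constant coefficient is
-- excluded by comparing coefficient sums. Above ω^ω nothing commutes with P: writing
-- z = ω^ω·u + v with u > 0, P absorbs ω^ω from the left, so P·z < ω^ω·u·2 ≤ z·ω ≤ z·P.
-- Hence the bound z < ω^(ω^λ) is only needed for the converse. Classical logic enters through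
-- the linearity of the order on Brouwer trees, which also yields Euclidean division.
module Submission where

open import Defs
open import Level using (0ℓ) renaming (suc to lsuc)
open import Axiom.ExcludedMiddle using (ExcludedMiddle)
open import Data.Empty using (⊥-elim)
open import Data.List using (List; []; _∷_; [_]; _++_; length; replicate)
import Data.List.Properties as List
open import Data.List.Relation.Unary.All using (All; []; _∷_)
open import Data.List.Relation.Unary.All.Properties using (replicate⁺)
open import Data.Maybe using (nothing; just)
open import Data.Nat using (ℕ; zero; suc)
import Data.Nat as ℕ
import Data.Nat.Properties as ℕ
open import Data.Nat.Induction using (<-wellFounded)
open import Data.Nat.ListAction using (sum)
open import Data.Nat.ListAction.Properties using (sum-++)
open import Data.Product using (_×_; _,_; proj₁; proj₂; ∃-syntax)
open import Data.Sum using (_⊎_; inj₁; inj₂)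
open import Induction.WellFounded using (Acc; acc)
open import Relation.Binary.Bundles using (Poset)
open import Relation.Binary.Definitions using (tri<; tri≈; tri>)
open import Relation.Binary.PropositionalEquality using (_≡_; _≢_; refl; sym; trans; cong; cong₂; subst)
open import Relation.Binary.Structures using (IsPartialOrder)
open import Relation.Nullary using (¬_; yes; no)

≤-refl : ∀ {x} → x ≤ x
≤-refl {ozero}   = ≤-zero
≤-refl {osucc x} = ≤-succ ≤-refl
≤-refl {osup f}  = ≤-limiting (λ k → ≤-cocone k ≤-refl)

≤-trans : ∀ {x y z} → x ≤ y → y ≤ z → x ≤ z
≤-trans ≤-zero           _                = ≤-zero
≤-trans (≤-limiting h)   q                = ≤-limiting (λ k → ≤-trans (h k) q)
≤-trans (≤-succ p)       (≤-succ q)       = ≤-succ (≤-trans p q)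
≤-trans (≤-succ p)       (≤-cocone k q)   = ≤-cocone k (≤-trans (≤-succ p) q)
≤-trans (≤-cocone k p)   (≤-cocone k′ q)  = ≤-cocone k′ (≤-trans (≤-cocone k p) q)
≤-trans (≤-cocone k p)   (≤-limiting h)   = ≤-trans p (h k)

≤-osup : ∀ {I : Set} {f : I → Ord} (k : I) → f k ≤ osup f
≤-osup k = ≤-cocone k ≤-refl

≤-osucc : ∀ {x} → x ≤ osucc x
≤-osucc {ozero}   = ≤-zero
≤-osucc {osucc x} = ≤-succ ≤-osucc
≤-osucc {osup f}  = ≤-limiting (λ k → ≤-trans ≤-osucc (≤-succ (≤-osup k)))

<⇒≤ : ∀ {x y} → x < y → x ≤ y
<⇒≤ = ≤-trans ≤-osucc

osucc-cancel-≤ : ∀ {x y} → osucc x ≤ osucc y → x ≤ y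
osucc-cancel-≤ (≤-succ p) = p

≤-<-trans : ∀ {x y z} → x ≤ y → y < z → x < z
≤-<-trans p = ≤-trans (≤-succ p)

<-irrefl : ∀ {x} → ¬ (x < x)
<-irrefl {osucc x} p              = <-irrefl (osucc-cancel-≤ p)
<-irrefl {osup f}  (≤-cocone k p) = <-irrefl (≤-trans (≤-succ (≤-osup k)) p)

<-osup-inv : ∀ {x} {I : Set} {f : I → Ord} → x < osup f → ∃[ k ] (x < f k)
<-osup-inv (≤-cocone k p) = k , p

≈-refl : ∀ {x} → x ≈ x
≈-refl = ≤-refl , ≤-refl

≈-sym : ∀ {x y} → x ≈ y → y ≈ x
≈-sym (p , q) = q , p

≈-trans : ∀ {x y z} → x ≈ y → y ≈ z → x ≈ z
≈-trans (p , q) (p′ , q′) = ≤-trans p p′ , ≤-trans q′ q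

osucc-cong : ∀ {x y} → x ≈ y → osucc x ≈ osucc y
osucc-cong (p , q) = ≤-succ p , ≤-succ q

≤-isPartialOrder : IsPartialOrder _≈_ _≤_
≤-isPartialOrder = record
  { isPreorder = record
    { isEquivalence = record { refl = ≈-refl ; sym = ≈-sym ; trans = ≈-trans }
    ; reflexive     = proj₁
    ; trans         = ≤-trans
    }
  ; antisym = _,_
  }

≤-poset : Poset (lsuc 0ℓ) (lsuc 0ℓ) (lsuc 0ℓ)
≤-poset = record { isPartialOrder = ≤-isPartialOrder }

open import Relation.Binary.Reasoning.PartialOrder ≤-poset
  using (begin_; begin-equality_; step-≤; step-≈-⟩; step-≈-⟨; step-≡-⟩; step-≡-⟨; _∎)

module Classical (em : ExcludedMiddle (lsuc 0ℓ)) where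

  ≤-<-connex : ∀ x y → x ≤ y ⊎ y < x
  ≤-<-connex ozero     y         = inj₁ ≤-zero
  ≤-<-connex (osucc x) ozero     = inj₂ (≤-succ ≤-zero)
  ≤-<-connex (osucc x) (osucc y) with ≤-<-connex x y
  ... | inj₁ p = inj₁ (≤-succ p)
  ... | inj₂ p = inj₂ (≤-succ p)
  ≤-<-connex (osucc x) (osup g) with em {∃[ k ] (osucc x ≤ g k)}
  ... | yes (k , p) = inj₁ (≤-cocone k p)
  ... | no ¬p       = inj₂ (≤-succ (≤-limiting g≤x))
    where
    g≤x : ∀ k → g k ≤ x
    g≤x k with ≤-<-connex (osucc x) (g k)
    ... | inj₁ p = ⊥-elim (¬p (k , p))
    ... | inj₂ p = osucc-cancel-≤ p
  ≤-<-connex (osup f) y with em {∃[ k ] (y < f k)}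
  ... | yes (k , p) = inj₂ (≤-cocone k p)
  ... | no ¬p       = inj₁ (≤-limiting f≤y)
    where
    f≤y : ∀ k → f k ≤ y
    f≤y k with ≤-<-connex (f k) y
    ... | inj₁ p = p
    ... | inj₂ p = ⊥-elim (¬p (k , p))

  ≰⇒> : ∀ {x y} → ¬ (x ≤ y) → y < x
  ≰⇒> {x} {y} x≰y with ≤-<-connex x y
  ... | inj₁ x≤y = ⊥-elim (x≰y x≤y)
  ... | inj₂ y<x = y<x

  ≮⇒≥ : ∀ {x y} → ¬ (x < y) → y ≤ x
  ≮⇒≥ {x} {y} x≮y with ≤-<-connex y x
  ... | inj₁ y≤x = y≤x
  ... | inj₂ x<y = ⊥-elim (x≮y x<y)

x≤x+y : ∀ x y → x ≤ x + y
x≤x+y x ozero     = ≤-refl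
x≤x+y x (osucc y) = ≤-trans (x≤x+y x y) ≤-osucc
x≤x+y x (osup f)  = ≤-osup nothing

y≤x+y : ∀ x y → y ≤ x + y
y≤x+y x ozero     = ≤-zero
y≤x+y x (osucc y) = ≤-succ (y≤x+y x y)
y≤x+y x (osup f)  = ≤-limiting (λ k → ≤-cocone (just k) (y≤x+y x (f k)))

+-monoʳ-≤ : ∀ x {y y′} → y ≤ y′ → x + y ≤ x + y′
+-monoʳ-≤ x {y′ = y′} ≤-zero = x≤x+y x y′
+-monoʳ-≤ x (≤-succ p)       = ≤-succ (+-monoʳ-≤ x p)
+-monoʳ-≤ x (≤-cocone k p)   = ≤-cocone (just k) (+-monoʳ-≤ x p)
+-monoʳ-≤ x {y′ = y′} (≤-limiting h) =
  ≤-limiting λ { nothing → x≤x+y x y′ ; (just k) → +-monoʳ-≤ x (h k) }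

+-monoʳ-< : ∀ x {y y′} → y < y′ → x + y < x + y′
+-monoʳ-< x = +-monoʳ-≤ x

+-monoˡ-≤ : ∀ {x x′} y → x ≤ x′ → x + y ≤ x′ + y
+-monoˡ-≤ ozero     p = p
+-monoˡ-≤ (osucc y) p = ≤-succ (+-monoˡ-≤ y p)
+-monoˡ-≤ (osup f)  p = ≤-limiting λ
  { nothing  → ≤-cocone nothing p
  ; (just k) → ≤-cocone (just k) (+-monoˡ-≤ (f k) p) }

+-mono-≤ : ∀ {x x′ y y′} → x ≤ x′ → y ≤ y′ → x + y ≤ x′ + y′
+-mono-≤ {x′ = x′} {y = y} p q = ≤-trans (+-monoˡ-≤ y p) (+-monoʳ-≤ x′ q)

+-cong : ∀ {x x′ y y′} → x ≈ x′ → y ≈ y′ → x + y ≈ x′ + y′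
+-cong (p , p′) (q , q′) = +-mono-≤ p q , +-mono-≤ p′ q′

+-congˡ : ∀ {x y y′} → y ≈ y′ → x + y ≈ x + y′
+-congˡ = +-cong ≈-refl

+-congʳ : ∀ {x x′} y → x ≈ x′ → x + y ≈ x′ + y
+-congʳ y p = +-cong p (≈-refl {y})

+-identityˡ : ∀ x → ozero + x ≈ x
+-identityˡ ozero     = ≈-refl
+-identityˡ (osucc x) = osucc-cong (+-identityˡ x)
+-identityˡ (osup f)  =
  ≤-limiting (λ { nothing → ≤-zero ; (just k) → ≤-cocone k (proj₁ (+-identityˡ (f k))) }) ,
  ≤-limiting (λ k → ≤-cocone (just k) (proj₂ (+-identityˡ (f k))))

+-assoc : ∀ x y z → (x + y) + z ≈ x + (y + z)
+-assoc x y ozero     = ≈-refl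
+-assoc x y (osucc z) = osucc-cong (+-assoc x y z)
+-assoc x y (osup f)  =
  ≤-limiting (λ
    { nothing  → ≤-osup (just nothing)
    ; (just k) → ≤-cocone (just (just k)) (proj₁ (+-assoc x y (f k))) }) ,
  ≤-limiting (λ
    { nothing         → ≤-trans (x≤x+y x y) (≤-osup nothing)
    ; (just nothing)  → ≤-osup nothing
    ; (just (just k)) → ≤-cocone (just k) (proj₂ (+-assoc x y (f k))) })

*-monoʳ-≤ : ∀ x {y y′} → y ≤ y′ → x * y ≤ x * y′
*-monoʳ-≤ x ≤-zero         = ≤-zero
*-monoʳ-≤ x (≤-succ p)     = +-monoˡ-≤ x (*-monoʳ-≤ x p)
*-monoʳ-≤ x (≤-cocone k p) = ≤-cocone k (*-monoʳ-≤ x p)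
*-monoʳ-≤ x (≤-limiting h) = ≤-limiting (λ k → *-monoʳ-≤ x (h k))

*-monoˡ-≤ : ∀ {x x′} y → x ≤ x′ → x * y ≤ x′ * y
*-monoˡ-≤ ozero     p = ≤-zero
*-monoˡ-≤ (osucc y) p = +-mono-≤ (*-monoˡ-≤ y p) p
*-monoˡ-≤ (osup f)  p = ≤-limiting (λ k → ≤-cocone k (*-monoˡ-≤ (f k) p))

*-mono-≤ : ∀ {x x′ y y′} → x ≤ x′ → y ≤ y′ → x * y ≤ x′ * y′
*-mono-≤ {x′ = x′} {y = y} p q = ≤-trans (*-monoˡ-≤ y p) (*-monoʳ-≤ x′ q)

*-cong : ∀ {x x′ y y′} → x ≈ x′ → y ≈ y′ → x * y ≈ x′ * y′
*-cong {x} {x′} {y} {y′} (p , p′) (q , q′) =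
  *-mono-≤ {x} {x′} {y} {y′} p q , *-mono-≤ {x′} {x} {y′} {y} p′ q′

*-congˡ : ∀ {x y y′} → y ≈ y′ → x * y ≈ x * y′
*-congˡ = *-cong ≈-refl

*-congʳ : ∀ {x x′} y → x ≈ x′ → x * y ≈ x′ * y
*-congʳ y p = *-cong p (≈-refl {y})

*-distribˡ-+ : ∀ x y z → x * (y + z) ≈ x * y + x * z
*-distribˡ-+ x y ozero     = ≈-refl
*-distribˡ-+ x y (osucc z) = ≈-trans (+-congʳ x (*-distribˡ-+ x y z)) (+-assoc (x * y) (x * z) x)
*-distribˡ-+ x y (osup f)  =
  ≤-limiting (λ { nothing → ≤-osup nothing
                ; (just k) → ≤-cocone (just k) (proj₁ (*-distribˡ-+ x y (f k))) }) ,
  ≤-limiting (λ { nothing → ≤-osup nothing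
                ; (just k) → ≤-cocone (just k) (proj₂ (*-distribˡ-+ x y (f k))) })

*-assoc : ∀ x y z → (x * y) * z ≈ x * (y * z)
*-assoc x y ozero     = ≈-refl
*-assoc x y (osucc z) = ≈-trans (+-congʳ (x * y) (*-assoc x y z)) (≈-sym (*-distribˡ-+ x (y * z) y))
*-assoc x y (osup f)  =
  ≤-limiting (λ k → ≤-cocone k (proj₁ (*-assoc x y (f k)))) ,
  ≤-limiting (λ k → ≤-cocone k (proj₂ (*-assoc x y (f k))))

*-identityʳ : ∀ x → x * oone ≈ x
*-identityʳ x = +-identityˡ x

*-identityˡ : ∀ x → oone * x ≈ x
*-identityˡ ozero     = ≈-refl
*-identityˡ (osucc x) = osucc-cong (*-identityˡ x)
*-identityˡ (osup f)  =
  ≤-limiting (λ k → ≤-cocone k (proj₁ (*-identityˡ (f k)))) ,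
  ≤-limiting (λ k → ≤-cocone k (proj₂ (*-identityˡ (f k))))

x≤x*y : ∀ x {y} → ozero < y → x ≤ x * y
x≤x*y x 0<y = ≤-trans (proj₂ (*-identityʳ x)) (*-monoʳ-≤ x 0<y)

*-positive : ∀ {x y} → ozero < x → ozero < y → ozero < x * y
*-positive {x} 0<x 0<y = ≤-trans 0<x (x≤x*y x 0<y)

*-monoʳ-< : ∀ {x} → ozero < x → ∀ {y y′} → y < y′ → x * y < x * y′
*-monoʳ-< {x} 0<x {y} y<y′ = ≤-trans (+-monoʳ-< (x * y) 0<x) (*-monoʳ-≤ x y<y′)

^ⁿ-comm : ∀ x r → x * x ^ⁿ r ≈ x ^ⁿ r * x
^ⁿ-comm x zero    = ≈-trans (*-identityʳ x) (≈-sym (*-identityˡ x))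
^ⁿ-comm x (suc r) = ≈-trans (≈-sym (*-assoc x (x ^ⁿ r) x)) (*-congʳ x (^ⁿ-comm x r))

^ⁿ-+ : ∀ x m n → x ^ⁿ (m ℕ.+ n) ≈ x ^ⁿ n * x ^ⁿ m
^ⁿ-+ x zero    n = ≈-sym (*-identityʳ (x ^ⁿ n))
^ⁿ-+ x (suc m) n = ≈-trans (*-congʳ x (^ⁿ-+ x m n)) (*-assoc (x ^ⁿ n) (x ^ⁿ m) x)

^ⁿ-positive : ∀ {x} → ozero < x → ∀ r → ozero < x ^ⁿ r
^ⁿ-positive 0<x zero    = ≤-refl
^ⁿ-positive 0<x (suc r) = *-positive (^ⁿ-positive 0<x r) 0<x

-- Euclidean division

record Division (a z : Ord) : Set₁ where
  field
    quotient          : Ord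
    remainder         : Ord
    remainder<divisor : remainder < a
    dividend≈         : z ≈ a * quotient + remainder

  quotient≤0⇒dividend<divisor : quotient ≤ ozero → z < a
  quotient≤0⇒dividend<divisor q≤0 = ≤-<-trans z≤r remainder<divisor
    where
    z≤r : z ≤ remainder
    z≤r = begin
      z                         ≤⟨ proj₁ dividend≈ ⟩
      a * quotient + remainder  ≤⟨ +-monoˡ-≤ remainder (*-monoʳ-≤ a q≤0) ⟩
      ozero + remainder         ≈⟨ +-identityˡ remainder ⟩
      remainder                 ∎

  divisor*quotient≤dividend : a * quotient ≤ z
  divisor*quotient≤dividend = ≤-trans (x≤x+y (a * quotient) remainder) (proj₂ dividend≈)

  dividend≤divisor*osucc-quotient : z ≤ a * osucc quotient
  dividend≤divisor*osucc-quotient =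
    ≤-trans (proj₁ dividend≈) (+-monoʳ-≤ (a * quotient) (<⇒≤ remainder<divisor))

open Division

module OrdinalDivision (em : ExcludedMiddle (lsuc 0ℓ)) where
  open Classical em

  division-≤ : ∀ {a z r} q → ozero < a → r ≤ a → z ≈ a * q + r → Division a z
  division-≤ {a} {z} {r} q 0<a r≤a z≈ with ≤-<-connex a r
  ... | inj₂ r<a = record
    { quotient = q ; remainder = r ; remainder<divisor = r<a ; dividend≈ = z≈ }
  ... | inj₁ a≤r = record
    { quotient = osucc q ; remainder = ozero ; remainder<divisor = 0<a
    ; dividend≈ = ≈-trans z≈ (+-congˡ (r≤a , a≤r)) }

  module _ {a : Ord} (0<a : ozero < a) {I : Set} {f : I → Ord} (d : ∀ k → Division a (f k)) where

    division-osup-max : (j : I) → (∀ k → quotient (d k) ≤ quotient (d j)) → Division a (osup f)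
    division-osup-max j max =
      division-≤ qⱼ 0<a (≤-limiting (λ k → selected≤a k (choice k))) (osup-f≤ , ≤-osup-f)
      where
      qⱼ : Ord
      qⱼ = quotient (d j)

      -- Only the terms whose quotient attains the maximum contribute to the remainder.
      selected : ∀ k → qⱼ ≤ quotient (d k) ⊎ quotient (d k) < qⱼ → Ord
      selected k (inj₁ _) = remainder (d k)
      selected k (inj₂ _) = ozero

      choice : ∀ k → qⱼ ≤ quotient (d k) ⊎ quotient (d k) < qⱼ
      choice k = ≤-<-connex qⱼ (quotient (d k))

      s : Ord
      s = osup (λ k → selected k (choice k))

      selected≤a : ∀ k t → selected k t ≤ a
      selected≤a k (inj₁ _) = <⇒≤ (remainder<divisor (d k))
      selected≤a k (inj₂ _) = ≤-zero

      term≤ : ∀ k t → f k ≤ a * qⱼ + selected k t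
      term≤ k (inj₁ _) = ≤-trans (proj₁ (dividend≈ (d k))) (+-monoˡ-≤ (remainder (d k)) (*-monoʳ-≤ a (max k)))
      term≤ k (inj₂ q<qⱼ) = ≤-trans (dividend≤divisor*osucc-quotient (d k)) (*-monoʳ-≤ a q<qⱼ)

      a*qⱼ≤ : a * qⱼ ≤ osup f
      a*qⱼ≤ = ≤-trans (divisor*quotient≤dividend (d j)) (≤-osup j)

      ≤term : ∀ k t → a * qⱼ + selected k t ≤ osup f
      ≤term k (inj₁ qⱼ≤q) =
        ≤-trans (+-monoˡ-≤ (remainder (d k)) (*-monoʳ-≤ a qⱼ≤q))
                (≤-trans (proj₂ (dividend≈ (d k))) (≤-osup k))
      ≤term k (inj₂ _) = a*qⱼ≤

      osup-f≤ : osup f ≤ a * qⱼ + s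
      osup-f≤ = ≤-limiting (λ k → ≤-trans (term≤ k (choice k)) (+-monoʳ-≤ (a * qⱼ) (≤-osup k)))

      ≤-osup-f : a * qⱼ + s ≤ osup f
      ≤-osup-f = ≤-limiting λ { nothing → a*qⱼ≤ ; (just k) → ≤term k (choice k) }

    division-osup-unbounded : ¬ (∃[ j ] (∀ k → quotient (d k) ≤ quotient (d j))) → Division a (osup f)
    division-osup-unbounded ¬max = record
      { quotient = osup (λ k → quotient (d k))
      ; remainder = ozero
      ; remainder<divisor = 0<a
      ; dividend≈ =
          ≤-limiting (λ j → ≤-trans (dividend≤divisor*osucc-quotient (d j))
                                    (≤-cocone (proj₁ (larger j)) (*-monoʳ-≤ a (proj₂ (larger j))))) ,
          ≤-limiting (λ k → ≤-trans (divisor*quotient≤dividend (d k)) (≤-osup k))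
      }
      where
      larger : ∀ j → ∃[ k ] (quotient (d j) < quotient (d k))
      larger j with em {∃[ k ] (quotient (d j) < quotient (d k))}
      ... | yes k = k
      ... | no ¬k = ⊥-elim (¬max (j , λ k → ≮⇒≥ (λ q<q′ → ¬k (k , q<q′))))

  division : ∀ {a} → ozero < a → ∀ z → Division a z
  division 0<a ozero = record
    { quotient = ozero ; remainder = ozero ; remainder<divisor = 0<a ; dividend≈ = ≈-refl }
  division 0<a (osucc z) =
    division-≤ (quotient d) 0<a (remainder<divisor d) (osucc-cong (dividend≈ d))
    where
    d = division 0<a z
  division 0<a (osup f)
    with em {∃[ j ] (∀ k → quotient (division 0<a (f k)) ≤ quotient (division 0<a (f j)))}
  ... | yes (j , max) = division-osup-max 0<a (λ k → division 0<a (f k)) j max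
  ... | no ¬max       = division-osup-unbounded 0<a (λ k → division 0<a (f k)) ¬max

-- Cantor normal forms below ω^ω

fin-+ : ∀ a b → fin a + fin b ≡ fin (b ℕ.+ a)
fin-+ a zero    = refl
fin-+ a (suc b) = cong osucc (fin-+ a b)

fin-* : ∀ a b → fin a * fin b ≡ fin (b ℕ.* a)
fin-* a zero    = refl
fin-* a (suc b) = trans (cong (_+ fin a) (fin-* a b)) (fin-+ (b ℕ.* a) a)

fin-mono-< : ∀ {a b} → a ℕ.< b → fin a < fin b
fin-mono-< {zero}  {suc b} _             = ≤-succ ≤-zero
fin-mono-< {suc a} {suc b} (ℕ.s≤s a<b) = ≤-succ (fin-mono-< a<b)

fin<ω : ∀ c → fin c < ω
fin<ω c = ≤-cocone (suc c) ≤-refl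

0<ω : ozero < ω
0<ω = fin<ω 0

fin*ω≤ω : ∀ c → fin c * ω ≤ ω
fin*ω≤ω c = ≤-limiting (λ j → subst (_≤ ω) (sym (fin-* c j)) (<⇒≤ (fin<ω (j ℕ.* c))))

ω^ⁿ-positive : ∀ m → ozero < ω ^ⁿ m
ω^ⁿ-positive = ^ⁿ-positive 0<ω

ω^ⁿ-absorbˡ : ∀ {x} m → x < ω ^ⁿ m → x + ω ^ⁿ m ≈ ω ^ⁿ m
ω^ⁿ-absorbˡ {x} zero    x<1     = ≤-succ (osucc-cancel-≤ x<1) , y≤x+y x oone
ω^ⁿ-absorbˡ {x} (suc m) x<ω^ⁿ1+m = x+ω^ⁿ1+m≤ , y≤x+y x (ω ^ⁿ suc m)
  where
  k = proj₁ (<-osup-inv x<ω^ⁿ1+m)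
  x≤ω^ⁿm*k : x ≤ ω ^ⁿ m * fin k
  x≤ω^ⁿm*k = <⇒≤ (proj₂ (<-osup-inv x<ω^ⁿ1+m))
  x+ω^ⁿ1+m≤ : x + ω ^ⁿ suc m ≤ ω ^ⁿ suc m
  x+ω^ⁿ1+m≤ = ≤-limiting λ
    { nothing  → ≤-cocone k x≤ω^ⁿm*k
    ; (just j) → ≤-cocone (j ℕ.+ k) (begin
        x + ω ^ⁿ m * fin j                ≤⟨ +-monoˡ-≤ (ω ^ⁿ m * fin j) x≤ω^ⁿm*k ⟩
        ω ^ⁿ m * fin k + ω ^ⁿ m * fin j   ≈⟨ *-distribˡ-+ (ω ^ⁿ m) (fin k) (fin j) ⟨
        ω ^ⁿ m * (fin k + fin j)          ≡⟨ cong (ω ^ⁿ m *_) (fin-+ k j) ⟩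
        ω ^ⁿ m * fin (j ℕ.+ k)            ∎) }

-- ⟦ c₀ ∷ c₁ ∷ … ∷ cₘ ⟧ = ω ^ⁿ m * fin cₘ + … + ω * fin c₁ + fin c₀ (least significant coefficient first).
⟦_⟧ : List ℕ → Ord
⟦ []     ⟧ = ozero
⟦ c ∷ cs ⟧ = ω * ⟦ cs ⟧ + fin c

-- Normal forms of nonzero ordinals: the last, leading coefficient is positive.
data Normal : List ℕ → Set where
  leading : ∀ {c} → Normal [ suc c ]
  extend  : ∀ {c cs} → Normal cs → Normal (c ∷ cs)

Normal⇒≢[] : ∀ {xs} → Normal xs → xs ≢ []
Normal⇒≢[] leading    ()
Normal⇒≢[] (extend _) ()

Canonical : List ℕ → Set
Canonical cs = cs ≡ [] ⊎ Normal cs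

Normal-tail : ∀ {c cs} → Normal (c ∷ cs) → Canonical cs
Normal-tail leading    = inj₁ refl
Normal-tail (extend n) = inj₂ n

Normal-++ : ∀ xs {ys} → Normal ys → Normal (xs ++ ys)
Normal-++ []       n = n
Normal-++ (x ∷ xs) n = extend (Normal-++ xs n)

Normal-++⁻ʳ : ∀ xs {y ys} → Normal (xs ++ y ∷ ys) → Normal (y ∷ ys)
Normal-++⁻ʳ []                n          = n
Normal-++⁻ʳ (x ∷ [])          (extend n) = n
Normal-++⁻ʳ (x ∷ x′ ∷ xs)     (extend n) = Normal-++⁻ʳ (x′ ∷ xs) n

ω*ω^ⁿ : ∀ m → ω * ω ^ⁿ m ≈ ω ^ⁿ suc m
ω*ω^ⁿ = ^ⁿ-comm ω

⟦⟧-++ : ∀ xs ys → ⟦ xs ++ ys ⟧ ≈ ω ^ⁿ length xs * ⟦ ys ⟧ + ⟦ xs ⟧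
⟦⟧-++ []       ys = ≈-sym (*-identityˡ ⟦ ys ⟧)
⟦⟧-++ (c ∷ xs) ys = begin-equality
  ω * ⟦ xs ++ ys ⟧ + fin c                  ≈⟨ +-congʳ (fin c) (*-congˡ (⟦⟧-++ xs ys)) ⟩
  ω * (ω^ⁿL * ⟦ ys ⟧ + ⟦ xs ⟧) + fin c       ≈⟨ +-congʳ (fin c) (*-distribˡ-+ ω (ω^ⁿL * ⟦ ys ⟧) ⟦ xs ⟧) ⟩
  ω * (ω^ⁿL * ⟦ ys ⟧) + ω * ⟦ xs ⟧ + fin c   ≈⟨ +-assoc (ω * (ω^ⁿL * ⟦ ys ⟧)) (ω * ⟦ xs ⟧) (fin c) ⟩
  ω * (ω^ⁿL * ⟦ ys ⟧) + ⟦ c ∷ xs ⟧           ≈⟨ +-congʳ ⟦ c ∷ xs ⟧ (*-assoc ω ω^ⁿL ⟦ ys ⟧) ⟨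
  ω * ω^ⁿL * ⟦ ys ⟧ + ⟦ c ∷ xs ⟧             ≈⟨ +-congʳ ⟦ c ∷ xs ⟧ (*-congʳ ⟦ ys ⟧ (ω*ω^ⁿ (length xs))) ⟩
  ω ^ⁿ suc (length xs) * ⟦ ys ⟧ + ⟦ c ∷ xs ⟧ ∎
  where
  ω^ⁿL = ω ^ⁿ length xs

⟦⟧-++-[_] : ∀ c xs → ⟦ xs ++ [ c ] ⟧ ≈ ω ^ⁿ length xs * fin c + ⟦ xs ⟧
⟦⟧-++-[ c ] xs = ≈-trans (⟦⟧-++ xs [ c ]) (+-congʳ ⟦ xs ⟧ (*-congˡ (+-identityˡ (fin c))))

⟦⟧<ω^ⁿlength : ∀ xs → ⟦ xs ⟧ < ω ^ⁿ length xs
⟦⟧<ω^ⁿlength []       = ≤-refl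
⟦⟧<ω^ⁿlength (c ∷ xs) = begin
  osucc (ω * ⟦ xs ⟧ + fin c)  ≤⟨ +-monoʳ-< (ω * ⟦ xs ⟧) (fin<ω c) ⟩
  ω * osucc ⟦ xs ⟧            ≤⟨ *-monoʳ-≤ ω (⟦⟧<ω^ⁿlength xs) ⟩
  ω * ω ^ⁿ length xs          ≈⟨ ω*ω^ⁿ (length xs) ⟩
  ω ^ⁿ suc (length xs)        ∎

ω^ⁿ-≤-⟦⟧ : ∀ {c cs} → Normal (c ∷ cs) → ω ^ⁿ length cs ≤ ⟦ c ∷ cs ⟧
ω^ⁿ-≤-⟦⟧ {suc c} leading = ≤-trans (≤-succ ≤-zero) (proj₂ (+-identityˡ (fin (suc c))))
ω^ⁿ-≤-⟦⟧ {c} {c′ ∷ cs} (extend n) = begin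
  ω ^ⁿ suc (length cs)       ≈⟨ ω*ω^ⁿ (length cs) ⟨
  ω * ω ^ⁿ length cs         ≤⟨ *-monoʳ-≤ ω (ω^ⁿ-≤-⟦⟧ n) ⟩
  ω * ⟦ c′ ∷ cs ⟧            ≤⟨ x≤x+y (ω * ⟦ c′ ∷ cs ⟧) (fin c) ⟩
  ω * ⟦ c′ ∷ cs ⟧ + fin c    ∎

⟦⟧-positive : ∀ {xs} → Normal xs → ozero < ⟦ xs ⟧
⟦⟧-positive {c ∷ cs} n = ≤-trans (ω^ⁿ-positive (length cs)) (ω^ⁿ-≤-⟦⟧ n)

⟦⟧*ω : ∀ {xs} → Normal xs → ⟦ xs ⟧ * ω ≈ ω ^ⁿ length xs
⟦⟧*ω {c ∷ cs} n = ⟦⟧*ω≤ , *-monoˡ-≤ ω (ω^ⁿ-≤-⟦⟧ n)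
  where
  m = length cs
  bound = <-osup-inv (⟦⟧<ω^ⁿlength (c ∷ cs))
  k = proj₁ bound
  ⟦⟧*ω≤ : ⟦ c ∷ cs ⟧ * ω ≤ ω ^ⁿ m * ω
  ⟦⟧*ω≤ = begin
    ⟦ c ∷ cs ⟧ * ω          ≤⟨ *-monoˡ-≤ ω (<⇒≤ (proj₂ bound)) ⟩
    ω ^ⁿ m * fin k * ω      ≈⟨ *-assoc (ω ^ⁿ m) (fin k) ω ⟩
    ω ^ⁿ m * (fin k * ω)    ≤⟨ *-monoʳ-≤ (ω ^ⁿ m) (fin*ω≤ω k) ⟩
    ω ^ⁿ m * ω              ∎

⟦⟧-*-ω*+ : ∀ {xs} → Normal xs → ∀ y c → ⟦ xs ⟧ * (ω * y + fin c) ≈ ω ^ⁿ length xs * y + ⟦ xs ⟧ * fin c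
⟦⟧-*-ω*+ {xs} n y c = begin-equality
  ⟦ xs ⟧ * (ω * y + fin c)               ≈⟨ *-distribˡ-+ ⟦ xs ⟧ (ω * y) (fin c) ⟩
  ⟦ xs ⟧ * (ω * y) + ⟦ xs ⟧ * fin c      ≈⟨ +-congʳ (⟦ xs ⟧ * fin c) (*-assoc ⟦ xs ⟧ ω y) ⟨
  ⟦ xs ⟧ * ω * y + ⟦ xs ⟧ * fin c        ≈⟨ +-congʳ (⟦ xs ⟧ * fin c) (*-congʳ y (⟦⟧*ω n)) ⟩
  ω ^ⁿ length xs * y + ⟦ xs ⟧ * fin c    ∎

⟦⟧-*-1∷ : ∀ {xs} → Normal xs → ∀ ys → ⟦ xs ⟧ * ⟦ 1 ∷ ys ⟧ ≈ ⟦ xs ++ ys ⟧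
⟦⟧-*-1∷ {xs} n ys = begin-equality
  ⟦ xs ⟧ * ⟦ 1 ∷ ys ⟧                      ≈⟨ ⟦⟧-*-ω*+ n ⟦ ys ⟧ 1 ⟩
  ω ^ⁿ length xs * ⟦ ys ⟧ + ⟦ xs ⟧ * oone  ≈⟨ +-congˡ (*-identityʳ ⟦ xs ⟧) ⟩
  ω ^ⁿ length xs * ⟦ ys ⟧ + ⟦ xs ⟧         ≈⟨ ⟦⟧-++ xs ys ⟨
  ⟦ xs ++ ys ⟧                             ∎

⟦replicate-0⟧ : ∀ m → ⟦ replicate m 0 ⟧ ≈ ozero
⟦replicate-0⟧ zero    = ≈-refl
⟦replicate-0⟧ (suc m) = *-congˡ (⟦replicate-0⟧ m)

⟦⟧-*-0∷ : ∀ {xs} → Normal xs → ∀ ys → ⟦ xs ⟧ * ⟦ 0 ∷ ys ⟧ ≈ ⟦ replicate (length xs) 0 ++ ys ⟧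
⟦⟧-*-0∷ {xs} n ys = begin-equality
  ⟦ xs ⟧ * ⟦ 0 ∷ ys ⟧                      ≈⟨ ⟦⟧-*-ω*+ n ⟦ ys ⟧ 0 ⟩
  ω ^ⁿ length xs * ⟦ ys ⟧                  ≡⟨ cong (λ m → ω ^ⁿ m * ⟦ ys ⟧) (List.length-replicate (length xs)) ⟨
  ω ^ⁿ length zeros * ⟦ ys ⟧               ≈⟨ +-congˡ (⟦replicate-0⟧ (length xs)) ⟨
  ω ^ⁿ length zeros * ⟦ ys ⟧ + ⟦ zeros ⟧   ≈⟨ ⟦⟧-++ zeros ys ⟨
  ⟦ zeros ++ ys ⟧                          ∎
  where
  zeros = replicate (length xs) 0

⟦⟧-++-[1]-*-fin : ∀ xs k → ⟦ xs ++ [ 1 ] ⟧ * fin (suc k) ≈ ⟦ xs ++ [ suc k ] ⟧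
⟦⟧-++-[1]-*-fin xs zero    = *-identityʳ ⟦ xs ++ [ 1 ] ⟧
⟦⟧-++-[1]-*-fin xs (suc k) = begin-equality
  ⟦ xs ++ [ 1 ] ⟧ * fin (suc k) + ⟦ xs ++ [ 1 ] ⟧  ≈⟨ +-cong (⟦⟧-++-[1]-*-fin xs k) (⟦⟧-++-[ 1 ] xs) ⟩
  ⟦ xs ++ [ suc k ] ⟧ + (A * oone + e)             ≈⟨ +-congʳ (A * oone + e) (⟦⟧-++-[ suc k ] xs) ⟩
  A * fin (suc k) + e + (A * oone + e)             ≈⟨ +-assoc (A * fin (suc k)) e (A * oone + e) ⟩
  A * fin (suc k) + (e + (A * oone + e))           ≈⟨ +-congˡ (+-assoc e (A * oone) e) ⟨
  A * fin (suc k) + (e + A * oone + e)             ≈⟨ +-congˡ (+-congʳ e (+-congˡ (*-identityʳ A))) ⟩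
  A * fin (suc k) + (e + A + e)                    ≈⟨ +-congˡ (+-congʳ e (ω^ⁿ-absorbˡ (length xs) (⟦⟧<ω^ⁿlength xs))) ⟩
  A * fin (suc k) + (A + e)                        ≈⟨ +-assoc (A * fin (suc k)) A e ⟨
  A * fin (suc (suc k)) + e                        ≈⟨ ⟦⟧-++-[ suc (suc k) ] xs ⟨
  ⟦ xs ++ [ suc (suc k) ] ⟧                        ∎
  where
  A = ω ^ⁿ length xs
  e = ⟦ xs ⟧

⟦⟧-++-[1]-*-suc∷ : ∀ xs k cs → ⟦ xs ++ [ 1 ] ⟧ * ⟦ suc k ∷ cs ⟧ ≈ ⟦ xs ++ suc k ∷ cs ⟧
⟦⟧-++-[1]-*-suc∷ xs k cs = begin-equality
  ⟦ xs ++ [ 1 ] ⟧ * ⟦ suc k ∷ cs ⟧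
    ≈⟨ ⟦⟧-*-ω*+ (Normal-++ xs leading) ⟦ cs ⟧ (suc k) ⟩
  ω ^ⁿ length (xs ++ [ 1 ]) * ⟦ cs ⟧ + ⟦ xs ++ [ 1 ] ⟧ * fin (suc k)
    ≡⟨ cong (λ m → ω ^ⁿ m * ⟦ cs ⟧ + ⟦ xs ++ [ 1 ] ⟧ * fin (suc k)) same-length ⟩
  ω ^ⁿ length (xs ++ [ suc k ]) * ⟦ cs ⟧ + ⟦ xs ++ [ 1 ] ⟧ * fin (suc k)
    ≈⟨ +-congˡ (⟦⟧-++-[1]-*-fin xs k) ⟩
  ω ^ⁿ length (xs ++ [ suc k ]) * ⟦ cs ⟧ + ⟦ xs ++ [ suc k ] ⟧
    ≈⟨ ⟦⟧-++ (xs ++ [ suc k ]) cs ⟨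
  ⟦ (xs ++ [ suc k ]) ++ cs ⟧
    ≡⟨ cong ⟦_⟧ (List.++-assoc xs [ suc k ] cs) ⟩
  ⟦ xs ++ suc k ∷ cs ⟧ ∎
  where
  same-length : length (xs ++ [ 1 ]) ≡ length (xs ++ [ suc k ])
  same-length = trans (List.length-++ xs) (sym (List.length-++ xs))

canonical-∷ : ∀ c {cs} → Canonical cs → ∃[ ds ] (Canonical ds × ⟦ ds ⟧ ≈ ⟦ c ∷ cs ⟧)
canonical-∷ zero    (inj₁ refl) = [] , inj₁ refl , ≈-refl
canonical-∷ (suc c) (inj₁ refl) = [ suc c ] , inj₂ leading , ≈-refl
canonical-∷ c       (inj₂ n)    = _ , inj₂ (extend n) , ≈-refl


module CantorNormalForm (em : ExcludedMiddle (lsuc 0ℓ)) where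
  open Classical em
  open OrdinalDivision em

  below-fin : ∀ {x} m → x ≤ fin m → ∃[ c ] (x ≈ fin c)
  below-fin zero    x≤0 = 0 , x≤0 , ≤-zero
  below-fin {x} (suc m) x≤1+m with ≤-<-connex (fin (suc m)) x
  ... | inj₁ 1+m≤x = suc m , x≤1+m , 1+m≤x
  ... | inj₂ x<1+m = below-fin m (osucc-cancel-≤ x<1+m)

  below-ω : ∀ {x} → x < ω → ∃[ c ] (x ≈ fin c)
  below-ω x<ω = below-fin m (<⇒≤ x<m)
    where
    m   = proj₁ (<-osup-inv x<ω)
    x<m = proj₂ (<-osup-inv x<ω)

  ⟦⟧-surjective : ∀ k {z} → z < ω ^ⁿ k → ∃[ cs ] (Canonical cs × z ≈ ⟦ cs ⟧)
  ⟦⟧-surjective zero    z<1 = [] , inj₁ refl , osucc-cancel-≤ z<1 , ≤-zero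
  ⟦⟧-surjective (suc k) {z} z<ω^ⁿ1+k =
    represent (⟦⟧-surjective k q<ω^ⁿk) (below-ω (remainder<divisor d))
    where
    d = division 0<ω z

    q<ω^ⁿk : quotient d < ω ^ⁿ k
    q<ω^ⁿk = ≰⇒> λ ω^ⁿk≤q → <-irrefl (begin
      osucc z               ≤⟨ z<ω^ⁿ1+k ⟩
      ω ^ⁿ suc k            ≈⟨ ω*ω^ⁿ k ⟨
      ω * ω ^ⁿ k            ≤⟨ *-monoʳ-≤ ω ω^ⁿk≤q ⟩
      ω * quotient d        ≤⟨ divisor*quotient≤dividend d ⟩
      z                     ∎)

    represent : ∃[ cs ] (Canonical cs × quotient d ≈ ⟦ cs ⟧) → ∃[ c ] (remainder d ≈ fin c)
              → ∃[ ds ] (Canonical ds × z ≈ ⟦ ds ⟧)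
    represent (cs , canonical , q≈) (c , r≈) with canonical-∷ c canonical
    ... | ds , canonical′ , ds≈ =
      ds , canonical′ , ≈-trans (dividend≈ d) (≈-trans (+-cong (*-congˡ q≈) r≈) (≈-sym ds≈))

  +-cancelˡ-fin : ∀ x a b → x + fin a ≈ x + fin b → a ≡ b
  +-cancelˡ-fin x a b (p , q) with ℕ.<-cmp a b
  ... | tri< a<b _ _ = ⊥-elim (<-irrefl (≤-<-trans q (+-monoʳ-< x (fin-mono-< a<b))))
  ... | tri≈ _ a≡b _ = a≡b
  ... | tri> _ _ b<a = ⊥-elim (<-irrefl (≤-<-trans p (+-monoʳ-< x (fin-mono-< b<a))))

  ω*+fin-mono-< : ∀ {x x′} c c′ → x < x′ → ω * x + fin c < ω * x′ + fin c′
  ω*+fin-mono-< {x} {x′} c c′ x<x′ = begin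
    osucc (ω * x + fin c)   ≤⟨ +-monoʳ-< (ω * x) (fin<ω c) ⟩
    ω * osucc x             ≤⟨ *-monoʳ-≤ ω x<x′ ⟩
    ω * x′                  ≤⟨ x≤x+y (ω * x′) (fin c′) ⟩
    ω * x′ + fin c′         ∎

  ⟦⟧-injective : ∀ {xs ys} → Canonical xs → Canonical ys → ⟦ xs ⟧ ≈ ⟦ ys ⟧ → xs ≡ ys
  ⟦⟧-injective (inj₁ refl) (inj₁ refl) _ = refl
  ⟦⟧-injective (inj₁ refl) (inj₂ n) (_ , ys≤0) = ⊥-elim (<-irrefl (≤-<-trans ys≤0 (⟦⟧-positive n)))
  ⟦⟧-injective (inj₂ n) (inj₁ refl) (xs≤0 , _) = ⊥-elim (<-irrefl (≤-<-trans xs≤0 (⟦⟧-positive n)))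
  ⟦⟧-injective {c ∷ cs} {c′ ∷ cs′} (inj₂ n) (inj₂ n′) e@(p , q) =
    cong₂ _∷_ c≡c′ (⟦⟧-injective (Normal-tail n) (Normal-tail n′) tails≈)
    where
    tails≈ : ⟦ cs ⟧ ≈ ⟦ cs′ ⟧
    tails≈ = ≮⇒≥ (λ cs′<cs → <-irrefl (≤-<-trans p (ω*+fin-mono-< c′ c cs′<cs)))
           , ≮⇒≥ (λ cs<cs′ → <-irrefl (≤-<-trans q (ω*+fin-mono-< c c′ cs<cs′)))
    c≡c′ : c ≡ c′
    c≡c′ = +-cancelˡ-fin (ω * ⟦ cs ⟧) c c′ (≈-trans e (+-congʳ (fin c′) (*-congˡ (≈-sym tails≈))))

++-split : ∀ {A : Set} (xs ys us vs : List A) → xs ++ ys ≡ us ++ vs →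
  (∃[ m ] (us ≡ xs ++ m × ys ≡ m ++ vs)) ⊎ (∃[ m ] (xs ≡ us ++ m × vs ≡ m ++ ys))
++-split []       ys us       vs eq = inj₁ (us , refl , eq)
++-split (x ∷ xs) ys []       vs eq = inj₂ (x ∷ xs , refl , sym eq)
++-split (x ∷ xs) ys (u ∷ us) vs eq with List.∷-injective eq
... | refl , eq′ with ++-split xs ys us vs eq′
...   | inj₁ (m , us≡ , ys≡) = inj₁ (m , cong (x ∷_) us≡ , ys≡)
...   | inj₂ (m , xs≡ , vs≡) = inj₂ (m , cong (x ∷_) xs≡ , vs≡)

All-proper-prefix : ∀ {A : Set} {Q : A → Set} {xs m ys z} →
  All Q ys → xs ++ m ≡ ys ++ [ z ] → m ≢ [] → All Q xs
All-proper-prefix {xs = []}                 _          _  _   = []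
All-proper-prefix {xs = x ∷ xs} {m} {[]}    _          eq m≢[] =
  ⊥-elim (m≢[] (List.++-conicalʳ xs m (List.∷-injectiveʳ eq)))
All-proper-prefix {Q = Q} {xs = x ∷ xs} {ys = y ∷ ys} (qy ∷ qys) eq m≢[] =
  subst Q (sym (List.∷-injectiveˡ eq)) qy ∷ All-proper-prefix qys (List.∷-injectiveʳ eq) m≢[]

length-<-∷-++ : ∀ {A : Set} (x : A) xs ys → length ys ℕ.< length (x ∷ xs ++ ys)
length-<-∷-++ x xs ys = ℕ.s≤s (subst (length ys ℕ.≤_) (sym (List.length-++ xs)) (ℕ.m≤n+m _ _))

-- P n = ω ^ⁿ (2 + n) + ω ^ⁿ n + … + ω + 1, whose coefficient list is 1 ∷ P-high n = P-low n ++ [ 1 ].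
P-high : ℕ → List ℕ
P-high n = replicate n 1 ++ 0 ∷ [ 1 ]

P-low : ℕ → List ℕ
P-low n = replicate (suc n) 1 ++ [ 0 ]

P-low-++-[1] : ∀ n → P-low n ++ [ 1 ] ≡ 1 ∷ P-high n
P-low-++-[1] n = cong (1 ∷_) (List.++-assoc (replicate n 1) [ 0 ] [ 1 ])

P-low≢P-high : ∀ n → P-low n ≢ P-high n
P-low≢P-high zero    ()
P-low≢P-high (suc n) eq = P-low≢P-high n (List.∷-injectiveʳ eq)

Normal-P-high : ∀ n → Normal (P-high n)
Normal-P-high n = Normal-++ (replicate n 1) (extend leading)

⟦P⟧ : ∀ n → P n ≈ ⟦ 1 ∷ P-high n ⟧
⟦P⟧ zero    = ≈-trans (*-identityˡ (osucc (ω * ω))) (osucc-cong (*-congˡ (≈-sym (*-identityʳ ω))))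
⟦P⟧ (suc n) = begin-equality
  osucc ω ^ⁿ n * osucc ω * osucc (ω * ω)    ≈⟨ *-congʳ (osucc (ω * ω)) (^ⁿ-comm (osucc ω) n) ⟨
  osucc ω * osucc ω ^ⁿ n * osucc (ω * ω)    ≈⟨ *-assoc (osucc ω) (osucc ω ^ⁿ n) (osucc (ω * ω)) ⟩
  osucc ω * P n                             ≈⟨ *-cong (osucc-cong (≈-sym (*-identityʳ ω))) (⟦P⟧ n) ⟩
  ⟦ 1 ∷ [ 1 ] ⟧ * ⟦ 1 ∷ P-high n ⟧           ≈⟨ ⟦⟧-*-1∷ (extend {1} (leading {0})) (P-high n) ⟩
  ⟦ 1 ∷ P-high (suc n) ⟧                    ∎

Normal-P : ∀ n → Normal (1 ∷ P-high n)
Normal-P n = extend (Normal-P-high n)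

⟦⟧-*-P : ∀ {xs} → Normal xs → ∀ n → ⟦ xs ⟧ * P n ≈ ⟦ xs ++ P-high n ⟧
⟦⟧-*-P {xs} normal n = ≈-trans (*-congˡ (⟦P⟧ n)) (⟦⟧-*-1∷ normal (P-high n))

P-*-⟦suc∷⟧ : ∀ n k cs → P n * ⟦ suc k ∷ cs ⟧ ≈ ⟦ P-low n ++ suc k ∷ cs ⟧
P-*-⟦suc∷⟧ n k cs = begin-equality
  P n * ⟦ suc k ∷ cs ⟧                ≈⟨ *-congʳ ⟦ suc k ∷ cs ⟧ (⟦P⟧ n) ⟩
  ⟦ 1 ∷ P-high n ⟧ * ⟦ suc k ∷ cs ⟧   ≡⟨ cong (λ ds → ⟦ ds ⟧ * ⟦ suc k ∷ cs ⟧) (P-low-++-[1] n) ⟨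
  ⟦ P-low n ++ [ 1 ] ⟧ * ⟦ suc k ∷ cs ⟧ ≈⟨ ⟦⟧-++-[1]-*-suc∷ (P-low n) k cs ⟩
  ⟦ P-low n ++ suc k ∷ cs ⟧           ∎

P-*-⟦0∷⟧ : ∀ n cs → P n * ⟦ 0 ∷ cs ⟧ ≈ ⟦ replicate (length (1 ∷ P-high n)) 0 ++ cs ⟧
P-*-⟦0∷⟧ n cs = ≈-trans (*-congʳ ⟦ 0 ∷ cs ⟧ (⟦P⟧ n)) (⟦⟧-*-0∷ (Normal-P n) cs)

¬All≡1-P-high : ∀ n → ¬ All (_≡ 1) (P-high n)
¬All≡1-P-high zero    (() ∷ _)
¬All≡1-P-high (suc n) (_ ∷ ones) = ¬All≡1-P-high n ones

ones-suffix-of-P-high : ∀ n m {xs} → m ++ xs ≡ P-high n → All (_≡ 1) xs → xs ≢ [] → xs ≡ [ 1 ]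
ones-suffix-of-P-high n       []            refl ones _     = ⊥-elim (¬All≡1-P-high n ones)
ones-suffix-of-P-high zero    (_ ∷ [])      eq   _    _     = List.∷-injectiveʳ eq
ones-suffix-of-P-high zero    (_ ∷ _ ∷ m) {xs} eq _ xs≢[] =
  ⊥-elim (xs≢[] (List.++-conicalʳ m xs (List.∷-injectiveʳ (List.∷-injectiveʳ eq))))
ones-suffix-of-P-high (suc n) (_ ∷ m)       eq   ones xs≢[] =
  ones-suffix-of-P-high n m (List.∷-injectiveʳ eq) ones xs≢[]

P-low-++-power : ∀ n {c cs r} → c ≡ 1 → ⟦ c ∷ cs ⟧ ≈ P n ^ⁿ r → ⟦ P-low n ++ c ∷ cs ⟧ ≈ P n ^ⁿ suc r
P-low-++-power n {cs = cs} {r} refl cs≈ = begin-equality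
  ⟦ P-low n ++ 1 ∷ cs ⟧   ≈⟨ P-*-⟦suc∷⟧ n 0 cs ⟨
  P n * ⟦ 1 ∷ cs ⟧        ≈⟨ *-congˡ cs≈ ⟩
  P n * P n ^ⁿ r          ≈⟨ ^ⁿ-comm (P n) r ⟩
  P n ^ⁿ suc r            ∎

-- The solutions are P-low n ++ … ++ P-low n ++ [ 1 ]: either xs is a proper prefix of P-low n,
-- which forces xs = [ 1 ], or xs = P-low n ++ xs′ for a shorter solution xs′.
conjugate⇒power : ∀ n {xs} → Normal xs → xs ++ P-high n ≡ P-low n ++ xs →
                  Acc ℕ._<_ (length xs) → ∃[ r ] (⟦ xs ⟧ ≈ P n ^ⁿ r)
conjugate⇒power n {xs} normal eq (acc rec) with ++-split xs (P-high n) (P-low n) xs eq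
... | inj₁ ([] , low≡ , high≡) =
  ⊥-elim (P-low≢P-high n (trans low≡ (trans (List.++-identityʳ xs) (sym high≡))))
... | inj₁ (m@(_ ∷ _) , low≡ , high≡) = 0 , subst (λ ys → ⟦ ys ⟧ ≈ oone) (sym xs≡[1]) ≈-refl
  where
  xs≡[1] : xs ≡ [ 1 ]
  xs≡[1] = ones-suffix-of-P-high n m (sym high≡)
             (All-proper-prefix (replicate⁺ (suc n) refl) (sym low≡) (λ ()))
             (Normal⇒≢[] normal)
... | inj₂ ([] , xs≡low , xs≡high) =
  ⊥-elim (P-low≢P-high n (trans (sym (List.++-identityʳ (P-low n))) (trans (sym xs≡low) xs≡high)))
... | inj₂ (c ∷ cs , xs≡ , xs≡′) =
  suc r , subst (λ ys → ⟦ ys ⟧ ≈ P n ^ⁿ suc r) (sym xs≡)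
                (P-low-++-power n {c} {cs} {r} (List.∷-injectiveˡ eq′) ⟦c∷cs⟧≈)
  where
  eq′ : (c ∷ cs) ++ P-high n ≡ P-low n ++ c ∷ cs
  eq′ = trans (sym xs≡′) xs≡
  normal′ : Normal (c ∷ cs)
  normal′ = Normal-++⁻ʳ (P-low n) (subst Normal xs≡ normal)
  shorter : length (c ∷ cs) ℕ.< length xs
  shorter = subst (λ ys → length (c ∷ cs) ℕ.< length ys) (sym xs≡)
              (length-<-∷-++ 1 (replicate n 1 ++ [ 0 ]) (c ∷ cs))
  ih : ∃[ r ] (⟦ c ∷ cs ⟧ ≈ P n ^ⁿ r)
  ih = conjugate⇒power n normal′ eq′ (rec shorter)
  r : ℕ
  r = proj₁ ih
  ⟦c∷cs⟧≈ : ⟦ c ∷ cs ⟧ ≈ P n ^ⁿ r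
  ⟦c∷cs⟧≈ = proj₂ ih

sum-P-high : ∀ n → sum (P-high n) ≡ suc n
sum-P-high zero    = refl
sum-P-high (suc n) = cong suc (sum-P-high n)

sum-replicate-0-++ : ∀ m cs → sum (replicate m 0 ++ cs) ≡ sum cs
sum-replicate-0-++ zero    cs = refl
sum-replicate-0-++ (suc m) cs = sum-replicate-0-++ m cs

++-P-high≢replicate-0-++ : ∀ n m cs → cs ++ P-high n ≢ replicate m 0 ++ cs
++-P-high≢replicate-0-++ n m cs eq =
  ℕ.m+1+n≢m (sum cs) (trans sum-lhs (trans (cong sum eq) (sum-replicate-0-++ m cs)))
  where
  sum-lhs : sum cs ℕ.+ suc n ≡ sum (cs ++ P-high n)
  sum-lhs = sym (trans (sum-++ cs (P-high n)) (cong (sum cs ℕ.+_) (sum-P-high n)))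

-- Ordinals above ω^ω

ω^ω : Ord
ω^ω = osup (ω ^ⁿ_)

0<ω^ω : ozero < ω^ω
0<ω^ω = ≤-cocone 0 ≤-refl

*-<ω^ω : ∀ {x y} → x < ω^ω → y < ω^ω → x * y < ω^ω
*-<ω^ω {x} {y} x<ω^ω y<ω^ω with <-osup-inv x<ω^ω | <-osup-inv y<ω^ω
... | a , x<ω^ⁿa | b , y<ω^ⁿb = begin
  osucc (x * y)         ≤⟨ ≤-succ (*-monoˡ-≤ y (<⇒≤ x<ω^ⁿa)) ⟩
  osucc (ω ^ⁿ a * y)    ≤⟨ *-monoʳ-< (ω^ⁿ-positive a) y<ω^ⁿb ⟩
  ω ^ⁿ a * ω ^ⁿ b       ≈⟨ ^ⁿ-+ ω b a ⟨
  ω ^ⁿ (b ℕ.+ a)        ≤⟨ ≤-osup (b ℕ.+ a) ⟩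
  ω^ω                   ∎

P<ω^ⁿ : ∀ n → P n < ω ^ⁿ length (1 ∷ P-high n)
P<ω^ⁿ n = ≤-<-trans (proj₁ (⟦P⟧ n)) (⟦⟧<ω^ⁿlength (1 ∷ P-high n))

P<ω^ω : ∀ n → P n < ω^ω
P<ω^ω n = ≤-trans (P<ω^ⁿ n) (≤-osup (length (1 ∷ P-high n)))

P*ω^ω≤ω^ω : ∀ n → P n * ω^ω ≤ ω^ω
P*ω^ω≤ω^ω n = ≤-limiting λ m → begin
  P n * ω ^ⁿ m              ≤⟨ *-monoˡ-≤ (ω ^ⁿ m) (<⇒≤ (P<ω^ⁿ n)) ⟩
  ω ^ⁿ L * ω ^ⁿ m           ≈⟨ ^ⁿ-+ ω m L ⟨
  ω ^ⁿ (m ℕ.+ L)            ≤⟨ ≤-osup (m ℕ.+ L) ⟩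
  ω^ω                       ∎
  where
  L = length (1 ∷ P-high n)

ω≤P : ∀ n → ω ≤ P n
ω≤P n = begin
  ω                         ≈⟨ *-identityʳ ω ⟨
  ω * oone                  ≤⟨ *-monoʳ-≤ ω (⟦⟧-positive (Normal-P-high n)) ⟩
  ω * ⟦ P-high n ⟧          ≤⟨ x≤x+y (ω * ⟦ P-high n ⟧) (fin 1) ⟩
  ⟦ 1 ∷ P-high n ⟧          ≈⟨ ⟦P⟧ n ⟨
  P n                       ∎

0<P : ∀ n → ozero < P n
0<P n = ≤-trans 0<ω (ω≤P n)

P^ⁿ<ω^ω : ∀ n r → P n ^ⁿ r < ω^ω
P^ⁿ<ω^ω n zero    = ≤-cocone 1 (≤-trans (fin<ω 1) (proj₂ (*-identityˡ ω)))
P^ⁿ<ω^ω n (suc r) = *-<ω^ω (P^ⁿ<ω^ω n r) (P<ω^ω n)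

P*z<z*P : ∀ n {z} (d : Division ω^ω z) → ozero < quotient d → P n * z < z * P n
P*z<z*P n {z} d 0<u = begin
  osucc (P n * z)                   ≤⟨ ≤-succ (*-monoʳ-≤ (P n) (proj₁ (dividend≈ d))) ⟩
  osucc (P n * (ω^ω * u + v))       ≈⟨ osucc-cong (*-distribˡ-+ (P n) (ω^ω * u) v) ⟩
  osucc (P n * (ω^ω * u) + P n * v) ≤⟨ ≤-succ (+-monoˡ-≤ (P n * v) P*ω^ω*u≤ω^ω*u) ⟩
  osucc (ω^ω * u + P n * v)         ≤⟨ +-monoʳ-< (ω^ω * u) (*-<ω^ω (P<ω^ω n) (remainder<divisor d)) ⟩
  ω^ω * u + ω^ω                     ≤⟨ +-mono-≤ (proj₂ (+-identityˡ (ω^ω * u))) (x≤x*y ω^ω 0<u) ⟩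
  ω^ω * u * fin 2                   ≤⟨ ≤-osup 2 ⟩
  ω^ω * u * ω                       ≤⟨ *-monoˡ-≤ ω (divisor*quotient≤dividend d) ⟩
  z * ω                             ≤⟨ *-monoʳ-≤ z (ω≤P n) ⟩
  z * P n                           ∎
  where
  u = quotient d
  v = remainder d
  P*ω^ω*u≤ω^ω*u : P n * (ω^ω * u) ≤ ω^ω * u
  P*ω^ω*u≤ω^ω*u = ≤-trans (proj₂ (*-assoc (P n) ω^ω u)) (*-monoˡ-≤ u (P*ω^ω≤ω^ω n))

ω^-positive : ∀ x → ozero < ω ^ x
ω^-positive ozero     = ≤-refl
ω^-positive (osucc x) = *-positive (ω^-positive x) 0<ω
ω^-positive (osup f)  = ≤-osup nothing

ω^-mono-≤ : ∀ {x y} → x ≤ y → ω ^ x ≤ ω ^ y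
ω^-mono-≤ {y = y} ≤-zero   = ω^-positive y
ω^-mono-≤ (≤-succ p)       = *-monoˡ-≤ ω (ω^-mono-≤ p)
ω^-mono-≤ (≤-cocone k p)   = ≤-cocone (just k) (ω^-mono-≤ p)
ω^-mono-≤ {y = y} (≤-limiting h) =
  ≤-limiting (λ { nothing → ω^-positive y ; (just k) → ω^-mono-≤ (h k) })

ω^ⁿ≡ω^fin : ∀ m → ω ^ⁿ m ≡ ω ^ fin m
ω^ⁿ≡ω^fin zero    = refl
ω^ⁿ≡ω^fin (suc m) = cong (_* ω) (ω^ⁿ≡ω^fin m)

ω^ω≤ω^ω^ : ∀ {x} → oone ≤ x → ω^ω ≤ ω ^ (ω ^ x)
ω^ω≤ω^ω^ {x} 1≤x = ≤-limiting λ m → begin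
  ω ^ⁿ m          ≡⟨ ω^ⁿ≡ω^fin m ⟩
  ω ^ fin m       ≤⟨ ω^-mono-≤ (≤-trans (<⇒≤ (fin<ω m)) ω≤ω^x) ⟩
  ω ^ (ω ^ x)     ∎
  where
  ω≤ω^x : ω ≤ ω ^ x
  ω≤ω^x = ≤-trans (proj₂ (*-identityˡ ω)) (ω^-mono-≤ 1≤x)

module Commuting (em : ExcludedMiddle (lsuc 0ℓ)) where
  open Classical em
  open OrdinalDivision em
  open CantorNormalForm em

  commuting-Normal⇒power : ∀ n {xs} → Normal xs → ⟦ xs ⟧ * P n ≈ P n * ⟦ xs ⟧ → ∃[ r ] (⟦ xs ⟧ ≈ P n ^ⁿ r)
  commuting-Normal⇒power n {zero ∷ cs} normal@(extend normal-cs) comm =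
    ⊥-elim (++-P-high≢replicate-0-++ n _ cs (List.∷-injectiveʳ coefficients≡))
    where
    coefficients≡ : (0 ∷ cs) ++ P-high n ≡ replicate (length (1 ∷ P-high n)) 0 ++ cs
    coefficients≡ = ⟦⟧-injective
      (inj₂ (Normal-++ (0 ∷ cs) (Normal-P-high n)))
      (inj₂ (Normal-++ (replicate (length (1 ∷ P-high n)) 0) normal-cs))
      (≈-trans (≈-sym (⟦⟧-*-P normal n)) (≈-trans comm (P-*-⟦0∷⟧ n cs)))
  commuting-Normal⇒power n {suc k ∷ cs} normal comm =
    conjugate⇒power n normal coefficients≡ (<-wellFounded _)
    where
    coefficients≡ : (suc k ∷ cs) ++ P-high n ≡ P-low n ++ suc k ∷ cs
    coefficients≡ = ⟦⟧-injective
      (inj₂ (Normal-++ (suc k ∷ cs) (Normal-P-high n)))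
      (inj₂ (Normal-++ (P-low n) normal))
      (≈-trans (≈-sym (⟦⟧-*-P normal n)) (≈-trans comm (P-*-⟦suc∷⟧ n k cs)))

  commuting-below-ω^ω⇒power : ∀ n {z} → ozero < z → z < ω^ω → z * P n ≈ P n * z → ∃[ r ] (z ≈ P n ^ⁿ r)
  commuting-below-ω^ω⇒power n {z} 0<z z<ω^ω comm
    with ⟦⟧-surjective (proj₁ (<-osup-inv z<ω^ω)) (proj₂ (<-osup-inv z<ω^ω))
  ... | [] , _ , (z≤0 , _) = ⊥-elim (<-irrefl (≤-trans 0<z z≤0))
  ... | cs , inj₂ normal , z≈ with commuting-Normal⇒power n normal
        (≈-trans (*-congʳ (P n) (≈-sym z≈)) (≈-trans comm (*-congˡ z≈)))
  ...   | r , cs≈ = r , ≈-trans z≈ cs≈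

  commuting⇒power : ∀ n {z} → ozero < z → z * P n ≈ P n * z → ∃[ r ] (z ≈ P n ^ⁿ r)
  commuting⇒power n {z} 0<z comm = by-quotient (division 0<ω^ω z)
    where
    by-quotient : Division ω^ω z → ∃[ r ] (z ≈ P n ^ⁿ r)
    by-quotient d with ≤-<-connex (quotient d) ozero
    ... | inj₁ u≤0 = commuting-below-ω^ω⇒power n 0<z (quotient≤0⇒dividend<divisor d u≤0) comm
    ... | inj₂ 0<u = ⊥-elim (<-irrefl (≤-trans (P*z<z*P n d 0<u) (proj₁ comm)))

mainTheorem2 : ExcludedMiddle (lsuc 0ℓ) →
    (λ' : Ord) → oone < λ' → (n : ℕ) → (z : Ord) →
      ((ozero < z × z < ω ^ (ω ^ λ') × z * P n ≈ P n * z) → ∃[ r ] (z ≈ P n ^ⁿ r))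
      × (∃[ r ] (z ≈ P n ^ⁿ r) → (ozero < z × z < ω ^ (ω ^ λ') × z * P n ≈ P n * z))
mainTheorem2 em λ' 1<λ' n z = (λ (0<z , _ , comm) → commuting⇒power n 0<z comm) , power-properties
  where
  open Commuting em

  power-properties : ∃[ r ] (z ≈ P n ^ⁿ r) → ozero < z × z < ω ^ (ω ^ λ') × z * P n ≈ P n * z
  power-properties (r , z≈) =
      ≤-trans (^ⁿ-positive (0<P n) r) (proj₂ z≈)
    , ≤-trans (≤-<-trans (proj₁ z≈) (P^ⁿ<ω^ω n r)) (ω^ω≤ω^ω^ (<⇒≤ 1<λ'))
    , (begin-equality
        z * P n            ≈⟨ *-congʳ (P n) z≈ ⟩
        P n ^ⁿ r * P n     ≈⟨ ^ⁿ-comm (P n) r ⟨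
        P n * P n ^ⁿ r     ≈⟨ *-congˡ z≈ ⟨
        P n * z            ∎)
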